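{- Let $(A,P,B,T,F)$ be a well-formed reversing Petri net, $\langle M,H\rangle$ a state such that for every $a\in A$, $|\{x\in P: a\in M(x)\}|=1$, and suppose $\langle M,H\rangle\xrightarrow{t}\langle M',H'\rangle$ is a forward step. Then (1) for all $a\in A$, $|\{x\in P: a\in M'(x)\}|=1$; and (2) for all $\beta\in B$, $|\{x\in P:\beta\in M(x)\}|\le|\{x\in P:\beta\in M'(x)\}|\le 1$.
   Context: A reversing Petri net (RPN) is a tuple $(A,P,B,T,F)$: $A$ is a finite set of bases (tokens), $\overline{A}=\{\overline a: a\in A\}$ a set of negative tokens; $P$ a finite set of places; $B\subseteq A\times A$ a set of undirected bonds, written $a-b$ for $(a,b)$, with negative bonds $\overline{B}=\{\overline\beta:\beta\in B\}$; $T$ a finite set of transitions; $F:(P\times T)\cup(T\times P)\to 2^{A\cup\overline A\cup B\cup\overline B}$ labels arcs. In each label $\ell=F(x,t)$ or $F(t,x)$ each token $a$ occurs at most once (as $a$ or $\overline a$), $(a,b)\in\ell$ implies $a,b\in\ell$, and labels $F(t,x)$ contain no negative tokens/bonds. Write ${}^\circ t=\{x:F(x,t)\neq\emptyset\}$, $t^\circ=\{x:F(t,x)\neq\emptyset\}$, $\mathrm{pre}(t)=\bigcup_{x}F(x,t)$, $\mathrm{post}(t)=\bigcup_x F(t,x)$. The RPN is well-formed if for all $t$: $A\cap\mathrm{pre}(t)=A\cap\mathrm{post}(t)$; $a-b\in\mathrm{pre}(t)$ implies $a-b\in\mathrm{post}(t)$; $F(t,x)\cap F(t,y)=\emptyset$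 for $x\neq y$. A marking is $M:P\to 2^{A\cup B}$ with $a-b\in M(x)\Rightarrow a,b\in M(x)$; a history is $H:T\to 2^{\mathbb N}$; a state is a pair $\langle M,H\rangle$. For $a\in A$, $C\subseteq A\cup B$: $\mathrm{con}(a,C)=(\{a\}\cap C)\cup\{\beta,b,c:$ there is a sequence $\beta_1,\dots,\beta_n$ with $\beta_i=(a_{i-1},a_i)\in C\cap B$, $a_i\in C\cap A$, $a_0=a$, and $\beta=(b,c)$ is one of the $\beta_i\}$. Forward step: $t$ is forward-enabled in $\langle M,H\rangle$ if (1) for $x\in{}^\circ t$, $a\in F(x,t)\Rightarrow a\in M(x)$ and $\overline a\in F(x,t)\Rightarrow a\notin M(x)$; (2) likewise for bonds $\beta,\overline\beta$; (3) if $a\in F(t,y_1)$, $b\in F(t,y_2)$, $y_1\neq y_2$, then $b\notin\mathrm{con}(a,M(x))$ for all $x\in{}^\circ t$; (4) if $\beta\in F(t,x)$ for some $x\in t^\circ$ and $\beta\in M(y)$ for some $y\in{}^\circ t$ then $\beta\in F(y,t)$. For such $t$, $\langle M,H\rangle\xrightarrow{t}\langle M',H'\rangle$ where $M'(x)=M(x)-\bigcup_{a\in F(x,t)}\mathrm{con}(a,M(x))$ if $x\in{}^\circ t$; $M'(x)=M(x)\cup F(t,x)\cup\bigcup_{a\in F(t,x)\cap F(y,t)}\mathrm{con}(a,M(y))$ if $x\in t^\circ$; $M'(x)=M(x)$ otherwise; $H'(t)=H(t)\cup\{\max(\{0\}\cup\bigcup_{t''\in T}H(t''))+1\}$ and $H'(t')=H(t')$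 for $t'\neq t$. -}

module Defs where

open import Data.Nat using (ℕ; suc; _⊔_)
open import Data.Fin using (Fin)
open import Data.Fin.Subset using (Subset; _∈_; _∉_; Nonempty; ∣_∣)
open import Data.Vec using (tabulate; lookup)
open import Data.List using (List; foldr; concatMap; allFin)
open import Data.List.Membership.Propositional using () renaming (_∈_ to _∈ᴸ_)
open import Data.Product using (_×_; _,_; proj₁; proj₂; Σ; ∃; ∃-syntax)
open import Data.Sum using (_⊎_)
open import Relation.Nullary using (¬_)
open import Relation.Binary.PropositionalEquality using (_≡_; _≢_)

infix 1 _⇔_
_⇔_ : Set → Set → Set
P ⇔ Q = (P → Q) × (Q → P)

-- A = Fin nA (bases), P = Fin nP (places), B = Fin nB (bonds, each with
-- its two end-bases given by `ends`, undirected), T = Fin nT (transitions).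
-- A label (subset of A ∪ Ā ∪ B ∪ B̄) is given by four subsets:
-- positive tokens, negative tokens, positive bonds, negative bonds.

record Label (nA nB : ℕ) : Set where
  field
    tok    : Subset nA
    ntok   : Subset nA
    bnd    : Subset nB
    nbnd   : Subset nB
open Label public

NonEmptyL : ∀ {nA nB} → Label nA nB → Set
NonEmptyL ℓ = Nonempty (tok ℓ) ⊎ Nonempty (ntok ℓ) ⊎ Nonempty (bnd ℓ) ⊎ Nonempty (nbnd ℓ)

record RawRPN : Set where
  field
    nA nP nB nT : ℕ
    ends : Fin nB → Fin nA × Fin nA
    Fpt  : Fin nP → Fin nT → Label nA nB
    Ftp  : Fin nT → Fin nP → Label nA nB
open RawRPN public

module Bonds {nA nB : ℕ} (ends : Fin nB → Fin nA × Fin nA) where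

  Joins : Fin nB → Fin nA → Fin nA → Set
  Joins β u v = ends β ≡ (u , v) ⊎ ends β ≡ (v , u)

  EndOf : Fin nA → Fin nB → Set
  EndOf c β = proj₁ (ends β) ≡ c ⊎ proj₂ (ends β) ≡ c

  -- a sequence β₁,…,βₙ (n ≥ 0) with βᵢ = (aᵢ₋₁,aᵢ) ∈ C ∩ B, aᵢ ∈ C ∩ A,
  -- a₀ = a; indexed by its last base aₙ.  C = (Ct, Cb).
  data Walk (Ct : Subset nA) (Cb : Subset nB) (a : Fin nA) : Fin nA → Set where
    start  : Walk Ct Cb a a
    extend : ∀ {u v} → Walk Ct Cb a u → (β : Fin nB) →
             β ∈ Cb → Joins β u v → v ∈ Ct → Walk Ct Cb a v

  data OnWalk {Ct Cb a} (β : Fin nB) : ∀ {v} → Walk Ct Cb a v → Set where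
    here  : ∀ {u v} {w : Walk Ct Cb a u} {p q} {r : v ∈ Ct} →
            OnWalk β (extend w β p q r)
    there : ∀ {u v} {w : Walk Ct Cb a u} {β′ p q} {r : v ∈ Ct} →
            OnWalk β w → OnWalk β (extend w β′ p q r)

  ConB : Fin nA → Subset nA → Subset nB → Fin nB → Set
  ConB a Ct Cb β = Σ (Fin nA) λ v → Σ (Walk Ct Cb a v) λ w → OnWalk β w

  ConT : Fin nA → Subset nA → Subset nB → Fin nA → Set
  ConT a Ct Cb c = (c ≡ a × c ∈ Ct) ⊎ (∃[ β ] (ConB a Ct Cb β × EndOf c β))

module _ (N : RawRPN) where
  open Bonds (ends N)

  LabelOK : Label (nA N) (nB N) → Set
  LabelOK ℓ = (∀ a → ¬ (a ∈ tok ℓ × a ∈ ntok ℓ))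
            × (∀ β → β ∈ bnd ℓ → proj₁ (ends N β) ∈ tok ℓ × proj₂ (ends N β) ∈ tok ℓ)

  NoNeg : Label (nA N) (nB N) → Set
  NoNeg ℓ = (∀ a → a ∉ ntok ℓ) × (∀ β → β ∉ nbnd ℓ)

  record IsRPN : Set where
    field
      -- B ⊆ A × A is a set of undirected pairs: distinct bond indices are
      -- distinct undirected pairs
      bonds-distinct : ∀ β β′ → Joins β (proj₁ (ends N β′)) (proj₂ (ends N β′)) → β ≡ β′
      in-labels  : ∀ x t → LabelOK (Fpt N x t)
      out-labels : ∀ t x → LabelOK (Ftp N t x) × NoNeg (Ftp N t x)

  _∈°_ : Fin (nP N) → Fin (nT N) → Set
  x ∈° t = NonEmptyL (Fpt N x t)

  _∈ᵒ_ : Fin (nP N) → Fin (nT N) → Set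
  x ∈ᵒ t = NonEmptyL (Ftp N t x)

  record WellFormed : Set where
    field
      tokens-pre⇒post : ∀ t a → (∃[ x ] a ∈ tok (Fpt N x t)) → ∃[ x ] a ∈ tok (Ftp N t x)
      tokens-post⇒pre : ∀ t a → (∃[ x ] a ∈ tok (Ftp N t x)) → ∃[ x ] a ∈ tok (Fpt N x t)
      bonds-pre⇒post  : ∀ t β → (∃[ x ] β ∈ bnd (Fpt N x t)) → ∃[ x ] β ∈ bnd (Ftp N t x)
      disj-tok  : ∀ t x y → x ≢ y → ∀ a → ¬ (a ∈ tok  (Ftp N t x) × a ∈ tok  (Ftp N t y))
      disj-ntok : ∀ t x y → x ≢ y → ∀ a → ¬ (a ∈ ntok (Ftp N t x) × a ∈ ntok (Ftp N t y))
      disj-bnd  : ∀ t x y → x ≢ y → ∀ β → ¬ (β ∈ bnd  (Ftp N t x) × β ∈ bnd  (Ftp N t y))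
      disj-nbnd : ∀ t x y → x ≢ y → ∀ β → ¬ (β ∈ nbnd (Ftp N t x) × β ∈ nbnd (Ftp N t y))

  -- States ⟨M,H⟩.  M(x) is given by its bases `mtok x` and bonds `mbnd x`;
  -- H(t) is a finite set of naturals, given as a list.

  record State : Set where
    field
      mtok : Fin (nP N) → Subset (nA N)
      mbnd : Fin (nP N) → Subset (nB N)
      hist : Fin (nT N) → List ℕ
  open State public

  IsMarking : State → Set
  IsMarking S = ∀ x β → β ∈ mbnd S x →
                proj₁ (ends N β) ∈ mtok S x × proj₂ (ends N β) ∈ mtok S x

  conT : State → Fin (nA N) → Fin (nP N) → Fin (nA N) → Set
  conT S a x = ConT a (mtok S x) (mbnd S x)

  conB : State → Fin (nA N) → Fin (nP N) → Fin (nB N) → Set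
  conB S a x = ConB a (mtok S x) (mbnd S x)

  maxHist : State → ℕ
  maxHist S = foldr _⊔_ 0 (concatMap (hist S) (allFin (nT N)))

  record ForwardEnabled (S : State) (t : Fin (nT N)) : Set where
    field
      c1-tok  : ∀ x → x ∈° t → ∀ a → a ∈ tok (Fpt N x t) → a ∈ mtok S x
      c1-ntok : ∀ x → x ∈° t → ∀ a → a ∈ ntok (Fpt N x t) → a ∉ mtok S x
      c2-bnd  : ∀ x → x ∈° t → ∀ β → β ∈ bnd (Fpt N x t) → β ∈ mbnd S x
      c2-nbnd : ∀ x → x ∈° t → ∀ β → β ∈ nbnd (Fpt N x t) → β ∉ mbnd S x
      c3 : ∀ a b y₁ y₂ → a ∈ tok (Ftp N t y₁) → b ∈ tok (Ftp N t y₂) → y₁ ≢ y₂ →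
           ∀ x → x ∈° t → ¬ conT S a x b
      c4 : ∀ β x y → x ∈ᵒ t → β ∈ bnd (Ftp N t x) → y ∈° t → β ∈ mbnd S y →
           β ∈ bnd (Fpt N y t)

  -- For a place x, M'(x) is obtained from M(x) by
  -- removing ⋃_{a ∈ F(x,t)} con(a,M(x)) if x ∈ °t, and by adding
  -- F(t,x) ∪ ⋃_{a ∈ F(t,x) ∩ F(y,t)} con(a,M(y)) if x ∈ t°
  -- (so M'(x) = M(x) if x ∉ °t ∪ t°).
  record ForwardStep (S : State) (t : Fin (nT N)) (S′ : State) : Set where
    field
      enabled : ForwardEnabled S t
      tok′ : ∀ x c → c ∈ mtok S′ x ⇔
             ( (c ∈ mtok S x × (x ∈° t → ¬ (∃[ a ] (a ∈ tok (Fpt N x t) × conT S a x c))))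
             ⊎ (x ∈ᵒ t × ( c ∈ tok (Ftp N t x)
                         ⊎ ∃[ a ] ∃[ y ] (a ∈ tok (Ftp N t x) × a ∈ tok (Fpt N y t) × conT S a y c))))
      bnd′ : ∀ x β → β ∈ mbnd S′ x ⇔
             ( (β ∈ mbnd S x × (x ∈° t → ¬ (∃[ a ] (a ∈ tok (Fpt N x t) × conB S a x β))))
             ⊎ (x ∈ᵒ t × ( β ∈ bnd (Ftp N t x)
                         ⊎ ∃[ a ] ∃[ y ] (a ∈ tok (Ftp N t x) × a ∈ tok (Fpt N y t) × conB S a y β))))
      hist-t  : ∀ n → n ∈ᴸ hist S′ t ⇔ (n ∈ᴸ hist S t ⊎ n ≡ suc (maxHist S))
      hist-t′ : ∀ t′ → t′ ≢ t → ∀ n → n ∈ᴸ hist S′ t′ ⇔ n ∈ᴸ hist S t′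

  placesOfTok : State → Fin (nA N) → ℕ
  placesOfTok S a = ∣ tabulate (λ x → lookup (mtok S x) a) ∣

  placesOfBnd : State → Fin (nB N) → ℕ
  placesOfBnd S β = ∣ tabulate (λ x → lookup (mbnd S x) β) ∣

-- Every base sits at exactly one place, so the bases carried by t are the
-- connected components con(a, M(x)) of input tokens a at pre-places x of t:
-- such a component moves as a whole to an output place of a (which exists by
-- well-formedness), and condition (3) of enabledness forbids it from also
-- reaching another output place.  Bases not carried by t stay where they are.
-- Hence the new marking is again a marking in which each base occupies one
-- place, so a bond, pinned down by its ends, occupies at most one place; and a
-- bond present before the step is either untouched or carried along.
-- Whether a base is carried is undecidable (con is defined by walks), but the
-- conclusions are decidable statements about ℕ, so the case split is done
-- under a double negation.
module Submission where

open import Defs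
open import Data.Nat using (ℕ; _≤_; _<_; z≤n)
open import Data.Nat.Properties using (≤-antisym; ≤-trans; ≤⇒≯) renaming (_≟_ to _≟ℕ_)
open import Data.Fin using (Fin; _≟_)
open import Data.Fin.Subset using (Subset; _∈_; _⊆_; ⁅_⁆; _-_; ∣_∣; Nonempty; Empty)
open import Data.Fin.Subset.Properties
  using (∣⁅x⁆∣≡1; x∈⁅x⁆; x∈⁅y⁆⇒x≡y; p⊆q⇒∣p∣≤∣q∣; Empty-unique; ∣⊥∣≡0; nonempty?;
         x∈p∧x≢y⇒x∈p-y; x∈p⇒∣p-x∣<∣p∣)
open import Data.Vec using (tabulate; lookup)
open import Data.Vec.Properties using ([]=⇒lookup; lookup⇒[]=; lookup∘tabulate)
open import Data.Product using (_×_; _,_; proj₁; proj₂; ∃-syntax; ∃!)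
open import Data.Sum using (inj₁; inj₂)
open import Relation.Nullary using (¬_; Dec; yes; no; contradiction)
open import Relation.Nullary.Decidable using (decidable-stable; ¬¬-excluded-middle)
open import Relation.Nullary.Negation using (¬¬-map)
open import Relation.Binary.PropositionalEquality using (_≡_; _≢_; refl; sym; trans; cong; subst)

private variable
  n k : ℕ
  p q : Subset n
  x y : Fin n

x∈p⇒1≤∣p∣ : x ∈ p → 1 ≤ ∣ p ∣
x∈p⇒1≤∣p∣ {x = x} {p = p} x∈p = subst (_≤ ∣ p ∣) (∣⁅x⁆∣≡1 x) (p⊆q⇒∣p∣≤∣q∣ ⁅x⁆⊆p)
  where
    ⁅x⁆⊆p : ⁅ x ⁆ ⊆ p
    ⁅x⁆⊆p y∈⁅x⁆ = subst (_∈ p) (sym (x∈⁅y⁆⇒x≡y x y∈⁅x⁆)) x∈p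

Empty⇒∣p∣≡0 : Empty p → ∣ p ∣ ≡ 0
Empty⇒∣p∣≡0 {n} empty = trans (cong ∣_∣ (Empty-unique empty)) (∣⊥∣≡0 n)

∣p∣≤1 : (∀ {x y} → x ∈ p → y ∈ p → x ≡ y) → ∣ p ∣ ≤ 1
∣p∣≤1 {p = p} same with nonempty? p
... | no empty = subst (_≤ 1) (sym (Empty⇒∣p∣≡0 empty)) z≤n
... | yes (x , x∈p) = subst (∣ p ∣ ≤_) (∣⁅x⁆∣≡1 x) (p⊆q⇒∣p∣≤∣q∣ p⊆⁅x⁆)
  where
    p⊆⁅x⁆ : p ⊆ ⁅ x ⁆
    p⊆⁅x⁆ y∈p = subst (_∈ ⁅ x ⁆) (same x∈p y∈p) (x∈⁅x⁆ x)

∃!⇒∣p∣≡1 : ∃! _≡_ (_∈ p) → ∣ p ∣ ≡ 1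
∃!⇒∣p∣≡1 (x , x∈p , unique) =
  ≤-antisym (∣p∣≤1 (λ y∈p z∈p → trans (sym (unique y∈p)) (unique z∈p))) (x∈p⇒1≤∣p∣ x∈p)

∣p∣≡1⇒∃! : ∣ p ∣ ≡ 1 → ∃! _≡_ (_∈ p)
∣p∣≡1⇒∃! {p = p} ∣p∣≡1 with nonempty? p
... | no empty = contradiction (trans (sym ∣p∣≡1) (Empty⇒∣p∣≡0 empty)) λ ()
... | yes (x , x∈p) = x , x∈p , unique
  where
    -- a second element y would survive in p - x, whose size is below ∣ p ∣ = 1
    unique : ∀ {y} → y ∈ p → x ≡ y
    unique {y} y∈p = decidable-stable (x ≟ y) λ x≢y →
      ≤⇒≯ (x∈p⇒1≤∣p∣ (x∈p∧x≢y⇒x∈p-y y∈p (λ y≡x → x≢y (sym y≡x))))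
          (subst (∣ p - x ∣ <_) ∣p∣≡1 (x∈p⇒∣p-x∣<∣p∣ x∈p))

∣p∣≤1∧q≢∅⇒∣p∣≤∣q∣ : ∣ p ∣ ≤ 1 → (Nonempty p → ¬ ¬ Nonempty q) → ∣ p ∣ ≤ ∣ q ∣
∣p∣≤1∧q≢∅⇒∣p∣≤∣q∣ {p = p} {q = q} ∣p∣≤1 q≠∅ with nonempty? p
... | no empty = subst (_≤ ∣ q ∣) (sym (Empty⇒∣p∣≡0 empty)) z≤n
... | yes p≠∅ = ≤-trans ∣p∣≤1 (x∈p⇒1≤∣p∣ (proj₂ (decidable-stable (nonempty? q) (q≠∅ p≠∅))))

-- placesOfTok N S a and placesOfBnd N S β are, by definition,
-- ∣ holders (mtok S) a ∣ and ∣ holders (mbnd S) β ∣.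
holders : (Fin n → Subset k) → Fin k → Subset n
holders m a = tabulate (λ x → lookup (m x) a)

module _ {m : Fin n → Subset k} {a : Fin k} where

  ∈-holders⁺ : a ∈ m x → x ∈ holders m a
  ∈-holders⁺ {x} a∈mx =
    lookup⇒[]= x (holders m a) (trans (lookup∘tabulate _ x) ([]=⇒lookup a∈mx))

  ∈-holders⁻ : x ∈ holders m a → a ∈ m x
  ∈-holders⁻ {x} x∈ =
    lookup⇒[]= a (m x) (trans (sym (lookup∘tabulate _ x)) ([]=⇒lookup x∈))

  ∃!⇒∣holders∣≡1 : ∃! _≡_ (λ x → a ∈ m x) → ∣ holders m a ∣ ≡ 1
  ∃!⇒∣holders∣≡1 (x , a∈mx , unique) =
    ∃!⇒∣p∣≡1 (x , ∈-holders⁺ a∈mx , λ y∈ → unique (∈-holders⁻ y∈))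

  ∣holders∣≡1⇒∃! : ∣ holders m a ∣ ≡ 1 → ∃! _≡_ (λ x → a ∈ m x)
  ∣holders∣≡1⇒∃! ∣h∣≡1 with ∣p∣≡1⇒∃! ∣h∣≡1
  ... | x , x∈ , unique = x , ∈-holders⁻ x∈ , λ a∈my → unique (∈-holders⁺ a∈my)

module BondsProperties {nA nB : ℕ} (ends : Fin nB → Fin nA × Fin nA) where
  open Bonds ends

  private variable
    Ct : Subset nA
    Cb : Subset nB
    a b c u v : Fin nA
    β : Fin nB

  Joins-sym : Joins β u v → Joins β v u
  Joins-sym (inj₁ e) = inj₂ e
  Joins-sym (inj₂ e) = inj₁ e

  EndOf-elim : (P : Fin nA → Set) → P (proj₁ (ends β)) × P (proj₂ (ends β)) →
               EndOf c β → P c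
  EndOf-elim P (p₁ , _) (inj₁ e) = subst P e p₁
  EndOf-elim P (_ , p₂) (inj₂ e) = subst P e p₂

  Walk-end∈ : a ∈ Ct → Walk Ct Cb a v → v ∈ Ct
  Walk-end∈ a∈ start = a∈
  Walk-end∈ a∈ (extend _ _ _ _ v∈) = v∈

  _++ʷ_ : Walk Ct Cb a u → Walk Ct Cb u v → Walk Ct Cb a v
  w ++ʷ start = w
  w ++ʷ extend w′ β β∈ j v∈ = extend (w ++ʷ w′) β β∈ j v∈

  reverseʷ : a ∈ Ct → Walk Ct Cb a v → Walk Ct Cb v a
  reverseʷ a∈ start = start
  reverseʷ a∈ (extend w β β∈ j _) =
    extend start β β∈ (Joins-sym j) (Walk-end∈ a∈ w) ++ʷ reverseʷ a∈ w

  OnWalk-ends : {w : Walk Ct Cb a v} → OnWalk β w →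
                ∃[ u ] ∃[ u′ ] Walk Ct Cb a u × Walk Ct Cb a u′ × Joins β u u′
  OnWalk-ends (here {w = w} {p} {q} {r}) = _ , _ , w , extend w _ p q r , q
  OnWalk-ends (there on) = OnWalk-ends on

  OnWalk⇒∈ : {w : Walk Ct Cb a v} → OnWalk β w → β ∈ Cb
  OnWalk⇒∈ (here {p = β∈}) = β∈
  OnWalk⇒∈ (there on) = OnWalk⇒∈ on

  ConT⇒Walk : ConT a Ct Cb c → Walk Ct Cb a c
  ConT⇒Walk (inj₁ (refl , _)) = start
  ConT⇒Walk (inj₂ (β , (_ , _ , on) , c-end)) with OnWalk-ends on
  ... | _ , _ , w , w′ , inj₁ refl = EndOf-elim (Walk _ _ _) (w , w′) c-end
  ... | _ , _ , w , w′ , inj₂ refl = EndOf-elim (Walk _ _ _) (w′ , w) c-end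

  Walk⇒ConT : a ∈ Ct → Walk Ct Cb a c → ConT a Ct Cb c
  Walk⇒ConT a∈ start = inj₁ (refl , a∈)
  Walk⇒ConT a∈ w@(extend _ β _ (inj₁ e) _) = inj₂ (β , (_ , w , here) , inj₂ (cong proj₂ e))
  Walk⇒ConT a∈ w@(extend _ β _ (inj₂ e) _) = inj₂ (β , (_ , w , here) , inj₁ (cong proj₁ e))

  ConT-sym : a ∈ Ct → ConT a Ct Cb c → ConT c Ct Cb a
  ConT-sym a∈ con = Walk⇒ConT (Walk-end∈ a∈ w) (reverseʷ a∈ w)
    where w = ConT⇒Walk con

  ConT-trans : a ∈ Ct → ConT a Ct Cb b → ConT b Ct Cb c → ConT a Ct Cb c
  ConT-trans a∈ con con′ = Walk⇒ConT a∈ (ConT⇒Walk con ++ʷ ConT⇒Walk con′)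

  module _ (closed : ∀ β → β ∈ Cb → proj₁ (ends β) ∈ Ct × proj₂ (ends β) ∈ Ct) where

    ConT⇒∈ : ConT a Ct Cb c → c ∈ Ct
    ConT⇒∈ (inj₁ (_ , c∈)) = c∈
    ConT⇒∈ (inj₂ (β , (_ , _ , on) , c-end)) =
      EndOf-elim (_∈ Ct) (closed β (OnWalk⇒∈ on)) c-end

    ConT⇒ConB : β ∈ Cb → EndOf c β → ConT a Ct Cb c → ConB a Ct Cb β
    ConT⇒ConB {β} β∈ (inj₁ refl) con =
      _ , extend (ConT⇒Walk con) β β∈ (inj₁ refl) (proj₂ (closed β β∈)) , here
    ConT⇒ConB {β} β∈ (inj₂ refl) con =
      _ , extend (ConT⇒Walk con) β β∈ (inj₂ refl) (proj₁ (closed β β∈)) , here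

module Placement (N : RawRPN) (S : State N) (one : ∀ a → placesOfTok N S a ≡ 1) where

  unique-place : ∀ a → ∃! _≡_ (λ x → a ∈ mtok S x)
  unique-place a = ∣holders∣≡1⇒∃! {m = mtok S} (one a)

  place : Fin (nA N) → Fin (nP N)
  place a = proj₁ (unique-place a)

  place-∈ : ∀ a → a ∈ mtok S (place a)
  place-∈ a = proj₁ (proj₂ (unique-place a))

  place-unique : ∀ {a x} → a ∈ mtok S x → place a ≡ x
  place-unique {a} = proj₂ (proj₂ (unique-place a))

  -- the place of a bond is that of its first end
  placesOfBnd≤1 : IsMarking N S → ∀ β → placesOfBnd N S β ≤ 1
  placesOfBnd≤1 marking β = ∣p∣≤1 λ {x} {y} x∈ y∈ →
    trans (sym (place-unique (first-end x x∈))) (place-unique (first-end y y∈))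
    where
      first-end : ∀ x → x ∈ holders (mbnd S) β → proj₁ (ends N β) ∈ mtok S x
      first-end x x∈ = proj₁ (marking x β (∈-holders⁻ {m = mbnd S} x∈))

module ForwardStepInvariants
  (N : RawRPN) (rpn : IsRPN N) (wf : WellFormed N)
  (S S′ : State N) (marking : IsMarking N S) (one : ∀ a → placesOfTok N S a ≡ 1)
  (t : Fin (nT N)) (step : ForwardStep N S t S′) where

  open Bonds (ends N)
  open BondsProperties (ends N)
  open IsRPN rpn
  open WellFormed wf
  open ForwardStep step
  open ForwardEnabled enabled
  open Placement N S one

  pre⇒marked : ∀ {a y} → a ∈ tok (Fpt N y t) → a ∈ mtok S y
  pre⇒marked {a} {y} a∈F = c1-tok y (inj₁ (a , a∈F)) a a∈F

  con⇒marked : ∀ {a y c} → conT N S a y c → c ∈ mtok S y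
  con⇒marked {y = y} = ConT⇒∈ (marking y)

  outputs-disconnected : ∀ {a b x y₁ y₂} →
    a ∈ tok (Ftp N t y₁) → b ∈ tok (Ftp N t y₂) → y₁ ≢ y₂ →
    a ∈ tok (Fpt N x t) → ¬ conT N S a x b
  outputs-disconnected {a} {b} {x} {y₁} {y₂} a∈F b∈F y₁≢y₂ a∈F′ =
    c3 a b y₁ y₂ a∈F b∈F y₁≢y₂ x (inj₁ (a , a∈F′))

  Moved : Fin (nA N) → Set
  Moved c = ∃[ a ] (a ∈ tok (Fpt N (place c) t) × conT N S a (place c) c)

  moved⇒unique : ∀ {c} → Moved c → ∃! _≡_ (λ x → c ∈ mtok S′ x)
  moved⇒unique {c} (a , a∈F , con) =
    x₁ , c∈x₁ , λ {y} c∈y → decidable-stable (x₁ ≟ y) λ x₁≢y → not-elsewhere x₁≢y c∈y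
    where
      x₀ = place c
      x₁ = proj₁ (tokens-pre⇒post t a (x₀ , a∈F))
      a∈F₁ = proj₂ (tokens-pre⇒post t a (x₀ , a∈F))
      c∈x₁ : c ∈ mtok S′ x₁
      c∈x₁ = proj₂ (tok′ x₁ c) (inj₂ (inj₁ (a , a∈F₁) , inj₂ (a , x₀ , a∈F₁ , a∈F , con)))
      not-elsewhere : ∀ {y} → x₁ ≢ y → ¬ c ∈ mtok S′ y
      not-elsewhere {y} x₁≢y c∈y with proj₁ (tok′ y c) c∈y
      ... | inj₁ (c∈M , kept) with place-unique c∈M
      ...   | refl = kept (inj₁ (a , a∈F)) (a , a∈F , con)
      not-elsewhere x₁≢y c∈y | inj₂ (_ , inj₁ c∈F) =
        outputs-disconnected a∈F₁ c∈F x₁≢y a∈F con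
      not-elsewhere x₁≢y c∈y | inj₂ (_ , inj₂ (a′ , y′ , a′∈F , a′∈F′ , con′))
        with place-unique (con⇒marked con′)
      ... | refl = outputs-disconnected a∈F₁ a′∈F x₁≢y a∈F
                     (ConT-trans (pre⇒marked a∈F) con (ConT-sym (pre⇒marked a′∈F′) con′))

  unmoved⇒unique : ∀ {c} → ¬ Moved c → ∃! _≡_ (λ x → c ∈ mtok S′ x)
  unmoved⇒unique {c} ¬moved =
    place c , proj₂ (tok′ (place c) c) (inj₁ (place-∈ c , λ _ → ¬moved)) , unique
    where
      unique : ∀ {y} → c ∈ mtok S′ y → place c ≡ y
      unique {y} c∈y with proj₁ (tok′ y c) c∈y
      ... | inj₁ (c∈M , _) = place-unique c∈M
      ... | inj₂ (_ , inj₁ c∈F) with tokens-post⇒pre t c (y , c∈F)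
      ...   | x , c∈F′ with place-unique (pre⇒marked c∈F′)
      ...     | refl = contradiction (c , c∈F′ , inj₁ (refl , place-∈ c)) ¬moved
      unique {y} c∈y | inj₂ (_ , inj₂ (a , y′ , _ , a∈F′ , con))
        with place-unique (con⇒marked con)
      ... | refl = contradiction (a , a∈F′ , con) ¬moved

  placesOfTok′≡1 : ∀ c → placesOfTok N S′ c ≡ 1
  placesOfTok′≡1 c = decidable-stable (placesOfTok N S′ c ≟ℕ 1)
    (¬¬-map (λ { (yes moved) → ∃!⇒∣holders∣≡1 (moved⇒unique moved)
               ; (no ¬moved) → ∃!⇒∣holders∣≡1 (unmoved⇒unique ¬moved) })
            ¬¬-excluded-middle)

  marking′ : IsMarking N S′
  marking′ x β β∈ = end∈ (inj₁ refl) , end∈ (inj₂ refl)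
    where
      end∈ : ∀ {c} → EndOf c β → c ∈ mtok S′ x
      end∈ {c} c-end with proj₁ (bnd′ x β) β∈
      ... | inj₁ (β∈M , kept) = proj₂ (tok′ x c) (inj₁
            ( EndOf-elim (_∈ mtok S x) (marking x β β∈M) c-end
            , λ x∈°t → λ { (a , a∈F , con) →
                kept x∈°t (a , a∈F , ConT⇒ConB (marking x) β∈M c-end con) } ))
      ... | inj₂ (x∈t° , inj₁ β∈F) = proj₂ (tok′ x c) (inj₂
            (x∈t° , inj₁ (EndOf-elim (_∈ tok (Ftp N t x)) (proj₂ (proj₁ (out-labels t x)) β β∈F) c-end)))
      ... | inj₂ (x∈t° , inj₂ (a , y , a∈F , a∈F′ , con)) = proj₂ (tok′ x c) (inj₂
            (x∈t° , inj₂ (a , y , a∈F , a∈F′ , inj₂ (β , con , c-end))))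

  bond-persists : ∀ {x β} → β ∈ mbnd S x → ¬ ¬ (∃[ y ] β ∈ mbnd S′ y)
  bond-persists {x} {β} β∈ = ¬¬-map persist ¬¬-excluded-middle
    where
      persist : Dec (∃[ a ] (a ∈ tok (Fpt N x t) × conB N S a x β)) → ∃[ y ] β ∈ mbnd S′ y
      persist (yes (a , a∈F , con)) with tokens-pre⇒post t a (x , a∈F)
      ... | x₁ , a∈F₁ =
        x₁ , proj₂ (bnd′ x₁ β) (inj₂ (inj₁ (a , a∈F₁) , inj₂ (a , x , a∈F₁ , a∈F , con)))
      persist (no ¬carried) = x , proj₂ (bnd′ x β) (inj₁ (β∈ , λ _ → ¬carried))

  placesOfBnd-mono : ∀ β → placesOfBnd N S β ≤ placesOfBnd N S′ β
  placesOfBnd-mono β = ∣p∣≤1∧q≢∅⇒∣p∣≤∣q∣ (placesOfBnd≤1 marking β) λ { (x , x∈) →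
    ¬¬-map (λ { (y , β∈) → y , ∈-holders⁺ {m = mbnd S′} β∈ })
           (bond-persists (∈-holders⁻ {m = mbnd S} x∈)) }

proposition1 : (N : RawRPN) → IsRPN N → WellFormed N →
    (S S′ : State N) → IsMarking N S →
    (∀ a → placesOfTok N S a ≡ 1) →
    (t : Fin (nT N)) → ForwardStep N S t S′ →
    (∀ a → placesOfTok N S′ a ≡ 1) ×
    (∀ β → placesOfBnd N S β ≤ placesOfBnd N S′ β × placesOfBnd N S′ β ≤ 1)
proposition1 N rpn wf S S′ marking one t step =
  placesOfTok′≡1 , λ β → placesOfBnd-mono β , placesOfBnd≤1 marking′ β
  where
    open ForwardStepInvariants N rpn wf S S′ marking one t step
    open Placement N S′ placesOfTok′≡1 using (placesOfBnd≤1)
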